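{- Let $S[1..n]$ be a string, $k\geq1$, and $\Gamma$ a minimal $k$-attractor of $S$. Then for every $1\leq i\leq n$, $|\Gamma\cap[i]_{\equiv_k}|\leq1$, where $[i]_{\equiv_k}$ is the $\equiv_k$-equivalence class of $i$.
   Context: $\Gamma\subseteq[1..n]$ is a $k$-attractor of $S$ if every substring $S[i..j]$ with $i\leq j<i+k$ has an occurrence $S[i'..j']=S[i..j]$ with $j''\in[i'..j']$ for some $j''\in\Gamma$; it is minimal if moreover $\Gamma\setminus\{j\}$ is not a $k$-attractor for any $j\in\Gamma$. Two positions $i,j\in[1..n]$ satisfy $i\equiv_k j$ iff $S''[i-k+1..i+k-1]=S''[j-k+1..j+k-1]$, where $S''[p]=\#$ (a symbol not in the alphabet) if $p<1$ or $p>n$ and $S''[p]=S[p]$ otherwise. -}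

module Defs where

open import Data.Nat using (ℕ; zero; suc; _+_; _∸_; _≤_; _<_)
open import Data.Integer as ℤ using (ℤ; +_; -[1+_])
open import Data.Vec using (Vec; []; _∷_)
open import Data.Maybe using (Maybe; just; nothing)
open import Data.Product using (Σ; ∃; _×_; _,_)
open import Relation.Binary.PropositionalEquality using (_≡_; _≢_)
open import Relation.Nullary using (¬_)

-- S''[p] : 1-based access into S extended by # (= nothing) outside [1..n].
ext : ∀ {A : Set} {n : ℕ} → Vec A n → ℤ → Maybe A
ext S -[1+ _ ] = nothing
ext S (+ zero) = nothing
ext [] (+ suc p) = nothing
ext (x ∷ S) (+ suc zero) = just x
ext (x ∷ S) (+ suc (suc p)) = ext S (+ suc p)

at : ∀ {A : Set} {n : ℕ} → Vec A n → ℕ → Maybe A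
at S p = ext S (+ p)

-- S[i'..j'] = S[i..j] (both assumed to be in range)
SameSubstring : ∀ {A : Set} {n : ℕ} → Vec A n → ℕ → ℕ → ℕ → ℕ → Set
SameSubstring S i j i' j' =
  (j' ∸ i' ≡ j ∸ i) × (∀ t → t ≤ j ∸ i → at S (i' + t) ≡ at S (i + t))

Positions : Set₁
Positions = ℕ → Set

IsAttractor : ∀ {A : Set} {n : ℕ} → Vec A n → ℕ → Positions → Set
IsAttractor {n = n} S k Γ =
  (∀ p → Γ p → 1 ≤ p × p ≤ n) ×
  (∀ i j → 1 ≤ i → i ≤ j → j ≤ n → j < i + k →
     ∃ λ i' → ∃ λ j' → 1 ≤ i' × i' ≤ j' × j' ≤ n ×
       SameSubstring S i j i' j' ×
       ∃ λ p → Γ p × i' ≤ p × p ≤ j')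

remove : Positions → ℕ → Positions
remove Γ j x = Γ x × x ≢ j

IsMinimalAttractor : ∀ {A : Set} {n : ℕ} → Vec A n → ℕ → Positions → Set
IsMinimalAttractor S k Γ =
  IsAttractor S k Γ × (∀ j → Γ j → ¬ IsAttractor S k (remove Γ j))

-- i ≡_k j  iff  S''[i-k+1..i+k-1] = S''[j-k+1..j+k-1]
EquivK : ∀ {A : Set} {n : ℕ} → Vec A n → ℕ → ℕ → ℕ → Set
EquivK S k i j =
  ∀ (d : ℤ) → ℤ.- (+ (k ∸ 1)) ℤ.≤ d → d ℤ.≤ + (k ∸ 1) →
    ext S (+ i ℤ.+ d) ≡ ext S (+ j ℤ.+ d)

module Submission where

-- Suppose j ≠ j' both lie in Γ and j ≡_k j'; the windows of radius k-1 around
-- j and j' in the #-padded string then coincide.  We show that Γ \ {j} is still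
-- a k-attractor, contradicting minimality.  Take a substring of length ≤ k and an
-- occurrence [a..b] of it covering j.  Since b - a ≤ k - 1, the whole of [a..b]
-- lies inside the window around j, so its shift by j' - j spells the same
-- characters; as the window contains no # inside [a..b], the shifted interval
-- [a'..b'] stays in [1..n].  It covers j' ∈ Γ \ {j}.

open import Defs
open import Data.Nat using (ℕ; zero; suc; _+_; _∸_; _≤_; _<_; z≤n; s≤s; _≟_)
open import Data.Nat.Properties as ℕP
  using (m+[n∸m]≡n; m+n∸m≡n; ∸-monoˡ-≤; m≤m+n; +-monoʳ-≤; +-identityʳ)
open import Data.Integer as ℤ using (ℤ; +_; -[1+_]; _⊖_)
open import Data.Integer.Properties as ℤP
  using (+-injective; pos-+; m-n≡m⊖n; ⊖-≤; ⊖-monoˡ-≤; m⊖n≤m; neg-mono-≤)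
open import Data.Integer.Tactic.RingSolver using (solve-∀)
open import Data.Vec using (Vec; []; _∷_)
open import Data.Maybe using (just)
open import Data.Product using (Σ; ∃; _×_; _,_; proj₁; proj₂)
open import Data.Empty using (⊥-elim)
open import Relation.Nullary using (yes; no)
open import Relation.Binary.PropositionalEquality

ext-just-inRange : ∀ {A : Set} {n} (S : Vec A n) z {x} → ext S z ≡ just x →
  Σ ℕ λ m → z ≡ + m × 1 ≤ m × m ≤ n
ext-just-inRange S -[1+ _ ] ()
ext-just-inRange S (+ zero) ()
ext-just-inRange [] (+ suc p) ()
ext-just-inRange (x ∷ S) (+ suc zero) e = 1 , refl , s≤s z≤n , s≤s z≤n
ext-just-inRange (x ∷ S) (+ suc (suc p)) e with ext-just-inRange S (+ suc p) e
... | m , z≡m , _ , m≤n = suc m , cong (λ q → + suc q) (+-injective z≡m) , s≤s z≤n , s≤s m≤n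

inRange-ext-just : ∀ {A : Set} {n} (S : Vec A n) m → 1 ≤ m → m ≤ n →
  ∃ λ x → ext S (+ m) ≡ just x
inRange-ext-just [] (suc m) _ ()
inRange-ext-just (x ∷ S) (suc zero) _ _ = x , refl
inRange-ext-just (x ∷ S) (suc (suc m)) _ (s≤s m≤n) = inRange-ext-just S (suc m) (s≤s z≤n) m≤n

Window : ∀ {A : Set} {n} → Vec A n → ℕ → ℕ → ℕ → Set
Window S K x y = ∀ d → ℤ.- (+ K) ℤ.≤ d → d ℤ.≤ + K → ext S (+ x ℤ.+ d) ≡ ext S (+ y ℤ.+ d)

window-through : ∀ {A : Set} {n} (S : Vec A n) K {x y z} →
  Window S K x z → Window S K y z → Window S K x y
window-through S K Wxz Wyz d lo hi = trans (Wxz d lo hi) (sym (Wyz d lo hi))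

offset-shift : ∀ a c t → + (a + c) ℤ.+ (t ⊖ c) ≡ + (a + t)
offset-shift a c t = begin
  + (a + c) ℤ.+ (t ⊖ c)            ≡⟨ cong₂ ℤ._+_ (pos-+ a c) (sym (m-n≡m⊖n t c)) ⟩
  (+ a ℤ.+ + c) ℤ.+ (+ t ℤ.- + c)  ≡⟨ cancel (+ a) (+ c) (+ t) ⟩
  + a ℤ.+ + t                      ≡⟨ sym (pos-+ a t) ⟩
  + (a + t)                        ∎
  where
  open ≡-Reasoning
  cancel : ∀ (A C T : ℤ) → (A ℤ.+ C) ℤ.+ (T ℤ.- C) ≡ A ℤ.+ T
  cancel = solve-∀

offset-base : ∀ J c m → + J ℤ.+ (0 ⊖ c) ≡ + m → J ≡ m + c
offset-base J c m e = +-injective (begin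
  + J                                 ≡⟨ regroup (+ J) (+ c) ⟩
  (+ J ℤ.+ (+ 0 ℤ.- + c)) ℤ.+ + c     ≡⟨ cong (λ q → (+ J ℤ.+ q) ℤ.+ + c) (m-n≡m⊖n 0 c) ⟩
  (+ J ℤ.+ (0 ⊖ c)) ℤ.+ + c           ≡⟨ cong (ℤ._+ + c) e ⟩
  + m ℤ.+ + c                         ≡⟨ sym (pos-+ m c) ⟩
  + (m + c)                           ∎)
  where
  open ≡-Reasoning
  regroup : ∀ (J C : ℤ) → J ≡ (J ℤ.+ (+ 0 ℤ.- C)) ℤ.+ C
  regroup = solve-∀

offset-bounded : ∀ t c K → t ≤ K → c ≤ K → ℤ.- (+ K) ℤ.≤ t ⊖ c × t ⊖ c ℤ.≤ + K
offset-bounded t c K t≤K c≤K =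
  ℤP.≤-trans (neg-mono-≤ (ℤ.+≤+ c≤K))
    (subst (ℤ._≤ t ⊖ c) (⊖-≤ {0} {c} z≤n) (⊖-monoˡ-≤ c {0} {t} z≤n)) ,
  ℤP.≤-trans (m⊖n≤m t c) (ℤ.+≤+ t≤K)

short-length : ∀ x y k → y < x + k → y ∸ x ≤ k ∸ 1
short-length zero y k y<k = ℕP.pred-mono-≤ y<k
short-length (suc x) zero k _ = z≤n
short-length (suc x) (suc y) k (s≤s y<x+k) = short-length x y k y<x+k

relocate : ∀ {A : Set} {n} (S : Vec A n) K a c len J' →
  c ≤ len → len ≤ K → 1 ≤ a → a + len ≤ n → Window S K (a + c) J' →
  Σ ℕ λ a' → 1 ≤ a' × a' + len ≤ n × J' ≡ a' + c ×
    (∀ t → t ≤ len → at S (a' + t) ≡ at S (a + t))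
relocate {n = n} S K a c len J' c≤len len≤K 1≤a a+len≤n W =
  a' , 1≤a' , a'+len≤n , J'≡a'+c , same
  where
  read : ∀ t → t ≤ len → ext S (+ (a + t)) ≡ ext S (+ J' ℤ.+ (t ⊖ c))
  read t t≤len =
    let (lo , hi) = offset-bounded t c K (ℕP.≤-trans t≤len len≤K) (ℕP.≤-trans c≤len len≤K)
    in trans (cong (ext S) (sym (offset-shift a c t))) (W (t ⊖ c) lo hi)
  -- the start a is a character, so the shifted start is an in-range position a'
  start : ∃ λ x → ext S (+ a) ≡ just x
  start = inRange-ext-just S a 1≤a (ℕP.≤-trans (m≤m+n a len) a+len≤n)
  start' : Σ ℕ λ m → + J' ℤ.+ (0 ⊖ c) ≡ + m × 1 ≤ m × m ≤ n
  start' = ext-just-inRange S _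
    (trans (sym (read 0 z≤n)) (trans (cong (λ q → ext S (+ q)) (+-identityʳ a)) (proj₂ start)))
  a' : ℕ
  a' = proj₁ start'
  1≤a' : 1 ≤ a'
  1≤a' = proj₁ (proj₂ (proj₂ start'))
  J'≡a'+c : J' ≡ a' + c
  J'≡a'+c = offset-base J' c a' (proj₁ (proj₂ start'))
  same : ∀ t → t ≤ len → at S (a' + t) ≡ at S (a + t)
  same t t≤len = begin
    ext S (+ (a' + t))              ≡⟨ cong (ext S) (sym (offset-shift a' c t)) ⟩
    ext S (+ (a' + c) ℤ.+ (t ⊖ c))  ≡⟨ cong (λ q → ext S (+ q ℤ.+ (t ⊖ c))) (sym J'≡a'+c) ⟩
    ext S (+ J' ℤ.+ (t ⊖ c))        ≡⟨ sym (read t t≤len) ⟩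
    ext S (+ (a + t))               ∎
    where open ≡-Reasoning
  -- the end a + len is a character, so the shifted end is in range as well
  end : ∃ λ x → ext S (+ (a + len)) ≡ just x
  end = inRange-ext-just S (a + len) (ℕP.≤-trans 1≤a (m≤m+n a len)) a+len≤n
  end' : Σ ℕ λ m → + (a' + len) ≡ + m × 1 ≤ m × m ≤ n
  end' = ext-just-inRange S _ (trans (same len ℕP.≤-refl) (proj₂ end))
  a'+len≤n : a' + len ≤ n
  a'+len≤n = subst (_≤ n) (sym (+-injective (proj₁ (proj₂ end')))) (proj₂ (proj₂ (proj₂ end')))

CoveredOccurrence : ∀ {A : Set} {n} → Vec A n → Positions → ℕ → ℕ → Set
CoveredOccurrence {n = n} S Γ x y =
  ∃ λ a → ∃ λ b → 1 ≤ a × a ≤ b × b ≤ n × SameSubstring S x y a b ×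
    ∃ λ p → Γ p × a ≤ p × p ≤ b

remove-duplicate : ∀ {A : Set} {n} (S : Vec A n) k (Γ : Positions) j j' →
  IsAttractor S k Γ → Γ j' → j ≢ j' → Window S (k ∸ 1) j j' →
  IsAttractor S k (remove Γ j)
remove-duplicate {n = n} S k Γ j j' (Γ⊆[1,n] , covers) Γj' j≢j' W =
  (λ p Γp → Γ⊆[1,n] p (proj₁ Γp)) , covers'
  where
  covers' : ∀ x y → 1 ≤ x → x ≤ y → y ≤ n → y < x + k → CoveredOccurrence S (remove Γ j) x y
  covers' x y 1≤x x≤y y≤n y<x+k with covers x y 1≤x x≤y y≤n y<x+k
  ... | a , b , 1≤a , a≤b , b≤n , (len≡ , chars) , p , Γp , a≤p , p≤b with p ≟ j
  ...   | no p≢j = a , b , 1≤a , a≤b , b≤n , (len≡ , chars) , p , (Γp , p≢j) , a≤p , p≤b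
  ...   | yes refl =
    a' , a' + len , 1≤a' , m≤m+n a' len , a'+len≤n ,
    (trans (m+n∸m≡n a' len) len≡ ,
     (λ t t≤ → trans (chars' t (subst (t ≤_) (sym len≡) t≤)) (chars t t≤))) ,
    j' , (Γj' , λ j'≡j → j≢j' (sym j'≡j)) ,
    subst (a' ≤_) (sym j'≡a'+c) (m≤m+n a' c) ,
    subst (_≤ a' + len) (sym j'≡a'+c) (+-monoʳ-≤ a' c≤len)
    where
    c len : ℕ
    c = p ∸ a
    len = b ∸ a
    c≤len : c ≤ len
    c≤len = ∸-monoˡ-≤ a p≤b
    len≤K : len ≤ k ∸ 1
    len≤K = subst (_≤ k ∸ 1) (sym len≡) (short-length x y k y<x+k)
    W' : Window S (k ∸ 1) (a + c) j'
    W' = subst (λ q → Window S (k ∸ 1) q j') (sym (m+[n∸m]≡n a≤p)) W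
    moved : Σ ℕ λ a' → 1 ≤ a' × a' + len ≤ n × j' ≡ a' + c ×
              (∀ t → t ≤ len → at S (a' + t) ≡ at S (a + t))
    moved = relocate S (k ∸ 1) a c len j' c≤len len≤K 1≤a
              (subst (_≤ n) (sym (m+[n∸m]≡n a≤b)) b≤n) W'
    a' : ℕ
    a' = proj₁ moved
    1≤a' : 1 ≤ a'
    1≤a' = proj₁ (proj₂ moved)
    a'+len≤n : a' + len ≤ n
    a'+len≤n = proj₁ (proj₂ (proj₂ moved))
    j'≡a'+c : j' ≡ a' + c
    j'≡a'+c = proj₁ (proj₂ (proj₂ (proj₂ moved)))
    chars' : ∀ t → t ≤ len → at S (a' + t) ≡ at S (a + t)
    chars' = proj₂ (proj₂ (proj₂ (proj₂ moved)))

lemma14 : {A : Set} (n : ℕ) (S : Vec A n) (k : ℕ) (Γ : Positions) →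
    1 ≤ k → IsMinimalAttractor S k Γ →
    ∀ i → 1 ≤ i → i ≤ n →
    ∀ j j' → Γ j → EquivK S k j i → Γ j' → EquivK S k j' i → j ≡ j'
lemma14 n S k Γ _ (attractor , minimal) i _ _ j j' Γj j≡ₖi Γj' j'≡ₖi with j ≟ j'
... | yes j≡j' = j≡j'
... | no j≢j' = ⊥-elim (minimal j Γj
        (remove-duplicate S k Γ j j' attractor Γj' j≢j'
          (window-through S (k ∸ 1) j≡ₖi j'≡ₖi)))
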